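{- Let $G=(V,E)$ be a simple connected graph with $n=|V|$, and let $\{V_1,V_2,V_3\}$ be a feasible tripartition of $V$ with $|V_1|\le|V_2|\le|V_3|$ and $|V_3|>\frac12 n$, to which neither a Merge nor a Pull operation is applicable. Then: 1) $|V_1|+|V_2|<\frac12 n$ (so $|V_1|<\frac14 n$), and $V_1$ and $V_2$ are not adjacent (so both are adjacent to $V_3$); 2) for any edge $(u,v)\in E$ with $u\in V_3$ and $v\in V_1$, the graph $G[V_3\setminus\{u\}]$ is disconnected, and every connected component $G[W]$ of $G[V_3\setminus\{u\}]$ satisfies $|W|\le|V_1|$ and $W$ is not adjacent to $V_1$; 3) for such a vertex $u$, no vertex of $V_1\cup V_2$ is adjacent to any vertex of $V_3$ other than $u$.
   Context: A feasible tripartition of $V$ is a partition into three non-empty parts each inducing a connected subgraph of $G$. Two disjoint vertex sets are adjacent if some edge joins them. A Merge operation is applicable to $\{V_1,V_2,V_3\}$ (with $|V_3|>\frac12 n$) if $V_1$ and $V_2$ are adjacent. A Pull operation is applicable if there exist $i\in\{1,2\}$ and a non-empty proper subset $U\subset V_3$ such that $G[U]$ and $G[V_3\setminus U]$ are connected, $U$ is adjacent to $V_i$, and $|V_i|+|U|<|V_3|$. -}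

module Defs where

open import Data.Nat using (ℕ; _+_; _*_; _<_; _≤_)
open import Data.Fin using (Fin)
open import Data.Fin.Subset public
  using (Subset; _∈_; _∉_; _⊆_; _⊂_; _∪_; _─_; _-_; ∣_∣; Nonempty; ⊤)
open import Data.Product using (Σ; ∃; _×_; _,_)
open import Data.Sum using (_⊎_)
open import Data.Empty using (⊥)
open import Relation.Nullary using (¬_)

record Graph (n : ℕ) : Set₁ where
  field
    Adj   : Fin n → Fin n → Set
    sym   : ∀ {x y} → Adj x y → Adj y x
    irrefl : ∀ {x} → ¬ Adj x x
open Graph public

module _ {n : ℕ} (G : Graph n) where

  data Walk (S : Subset n) : Fin n → Fin n → Set where
    here : ∀ {x} → x ∈ S → Walk S x x
    step : ∀ {x y z} → x ∈ S → Adj G x y → Walk S y z → Walk S x z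

  Connected : Subset n → Set
  Connected S = Nonempty S × (∀ x y → x ∈ S → y ∈ S → Walk S x y)

  AdjacentSets : Subset n → Subset n → Set
  AdjacentSets A B = ∃ λ x → ∃ λ y → x ∈ A × y ∈ B × Adj G x y

  Component : Subset n → Subset n → Set
  Component S W =
    W ⊆ S × Connected W × (∀ W' → W ⊆ W' → W' ⊆ S → Connected W' → W' ⊆ W)

  FeasibleTripartition : Subset n → Subset n → Subset n → Set
  FeasibleTripartition V₁ V₂ V₃ =
    (∀ x → x ∈ V₁ ⊎ x ∈ V₂ ⊎ x ∈ V₃) ×
    (∀ x → x ∈ V₁ → x ∈ V₂ → ⊥) ×
    (∀ x → x ∈ V₁ → x ∈ V₃ → ⊥) ×
    (∀ x → x ∈ V₂ → x ∈ V₃ → ⊥) ×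
    Connected V₁ × Connected V₂ × Connected V₃

  MergeApplicable : Subset n → Subset n → Subset n → Set
  MergeApplicable V₁ V₂ V₃ = AdjacentSets V₁ V₂

  PullVia : Subset n → Subset n → Subset n → Set
  PullVia Vᵢ V₃ U =
    U ⊂ V₃ × Nonempty U × Connected U × Connected (V₃ ─ U) ×
    AdjacentSets U Vᵢ × ∣ Vᵢ ∣ + ∣ U ∣ < ∣ V₃ ∣

  PullApplicable : Subset n → Subset n → Subset n → Set
  PullApplicable V₁ V₂ V₃ = ∃ λ U → PullVia V₁ V₃ U ⊎ PullVia V₂ V₃ U

module Submission where

-- The theorem then follows by exhibiting, in each case, a forbidden Pull:
--   1) |V₁|+|V₂| < |V₃| is counting; V₁,V₂ touch V₃ because G is connected and
--      Merge is forbidden;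
--   2) for an edge uv (u ∈ V₃, v ∈ V₁): if V₃ - u were connected, U = {u} could be
--      pulled to V₁; a component W of V₃ - u with |W| > |V₁| would let V₃ ─ W be
--      pulled to V₁ (via the edge uv); hence |W| ≤ |V₁|, and then W itself could be
--      pulled to V₁ if it touched V₁;
--   3) an edge from V₁ ∪ V₂ to y ∈ V₃ - u would let the component of y be pulled.

open import Defs
open import Data.Nat using (ℕ; zero; suc; _+_; _*_; _<_; _≤_)
open import Data.Nat.Properties
  using (+-suc; +-identityʳ; +-comm; +-monoʳ-≤; +-monoʳ-<; +-cancelʳ-<; *-monoʳ-≤;
         ≤-trans; ≤-<-trans; ≰⇒>; _≤?_; module ≤-Reasoning)
open import Data.Nat.Tactic.RingSolver using (solve-∀)
open import Data.Fin using (Fin; zero; suc)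
open import Data.Fin.Properties using () renaming (_≟_ to _≟ᶠ_)
open import Data.Fin.Subset using (inside; outside; ⁅_⁆)
open import Data.Fin.Subset.Properties
  using (_∈?_; ⊆-antisym; x∈p∪q⁻; x∈p∪q⁺; p─q⊆p; x∈p∧x∉q⇒x∈p─q; x∈p∧x≢y⇒x∈p-y;
         x∈⁅x⁆; x∈⁅y⁆⇒x≡y; ∣⁅x⁆∣≡1; ∣⊤∣≡n; ∈⊤; p⊆q⇒∣p∣≤∣q∣)
open import Data.Vec using ([]; _∷_; here; there)
open import Data.Product using (∃; _×_; _,_; proj₁; proj₂)
open import Data.Sum using (_⊎_; inj₁; inj₂; [_,_]′)
open import Data.Empty using (⊥; ⊥-elim)
open import Function using (_∘_)
open import Relation.Nullary using (¬_; Dec; yes; no)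
open import Relation.Nullary.Decidable using (decidable-stable; ¬¬-excluded-middle)
open import Relation.Binary.PropositionalEquality as ≡ using (_≡_; refl; cong; subst; subst₂)

x∈p─q⇒x∉q : ∀ {n} {x : Fin n} (p q : Subset n) → x ∈ p ─ q → x ∉ q
x∈p─q⇒x∉q (s ∷ p) (inside ∷ q) () here
x∈p─q⇒x∉q (s ∷ p) (t ∷ q) (there h) (there h') = x∈p─q⇒x∉q p q h h'

∣p∪q∣≡∣p∣+∣q∣ : ∀ {n} (p q : Subset n) → (∀ {x} → x ∈ p → x ∉ q) →
  ∣ p ∪ q ∣ ≡ ∣ p ∣ + ∣ q ∣
∣p∪q∣≡∣p∣+∣q∣ [] [] _ = refl
∣p∪q∣≡∣p∣+∣q∣ (inside ∷ p) (inside ∷ q) disj = ⊥-elim (disj here here)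
∣p∪q∣≡∣p∣+∣q∣ (inside ∷ p) (outside ∷ q) disj =
  cong suc (∣p∪q∣≡∣p∣+∣q∣ p q (λ h h' → disj (there h) (there h')))
∣p∪q∣≡∣p∣+∣q∣ (outside ∷ p) (inside ∷ q) disj =
  ≡.trans (cong suc (∣p∪q∣≡∣p∣+∣q∣ p q (λ h h' → disj (there h) (there h'))))
          (≡.sym (+-suc (∣ p ∣) (∣ q ∣)))
∣p∪q∣≡∣p∣+∣q∣ (outside ∷ p) (outside ∷ q) disj =
  ∣p∪q∣≡∣p∣+∣q∣ p q (λ h h' → disj (there h) (there h'))

∣p─q∣+∣q∣≡∣p∣ : ∀ {n} (p q : Subset n) → q ⊆ p → ∣ p ─ q ∣ + ∣ q ∣ ≡ ∣ p ∣
∣p─q∣+∣q∣≡∣p∣ p q q⊆p =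
  ≡.trans (≡.sym (∣p∪q∣≡∣p∣+∣q∣ (p ─ q) q (x∈p─q⇒x∉q p q)))
          (cong ∣_∣ (⊆-antisym split-⊆ split-⊇))
  where
  split-⊆ : (p ─ q) ∪ q ⊆ p
  split-⊆ h = [ p─q⊆p p q , q⊆p ]′ (x∈p∪q⁻ (p ─ q) q h)
  split-⊇ : p ⊆ (p ─ q) ∪ q
  split-⊇ {x} h with x ∈? q
  ... | yes x∈q = x∈p∪q⁺ (inj₂ x∈q)
  ... | no x∉q = x∈p∪q⁺ (inj₁ (x∈p∧x∉q⇒x∈p─q h x∉q))

p─[p─q]≡q : ∀ {n} (p q : Subset n) → q ⊆ p → p ─ (p ─ q) ≡ q
p─[p─q]≡q p q q⊆p = ⊆-antisym twice-⊆ twice-⊇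
  where
  twice-⊆ : p ─ (p ─ q) ⊆ q
  twice-⊆ {x} h = decidable-stable (x ∈? q) λ x∉q →
    x∈p─q⇒x∉q p (p ─ q) h (x∈p∧x∉q⇒x∈p─q (p─q⊆p p (p ─ q) h) x∉q)
  twice-⊇ : q ⊆ p ─ (p ─ q)
  twice-⊇ h = x∈p∧x∉q⇒x∈p─q (q⊆p h) (λ h' → x∈p─q⇒x∉q p q h' h)

Represents : ∀ {n} → Subset n → (Fin n → Set) → Set
Represents R P = (∀ {z} → z ∈ R → P z) × (∀ {z} → P z → z ∈ R)

-- Classically every predicate on a finite set is a subset; constructively this
-- holds under double negation, which suffices for proving negations.
¬¬-representable : ∀ {n} (P : Fin n → Set) → ¬ ¬ (∃ λ R → Represents R P)
¬¬-representable {zero} P k = k ([] , (λ ()) , λ { {()} })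
¬¬-representable {suc n} P k =
  ¬¬-excluded-middle λ P0? → ¬¬-representable (P ∘ suc) λ (R , sound , complete) →
    k (extend P0? R sound complete)
  where
  extend : Dec (P zero) → (R : Subset n) → (∀ {z} → z ∈ R → P (suc z)) →
           (∀ {z} → P (suc z) → z ∈ R) → ∃ λ R' → Represents R' P
  extend (yes p0) R sound complete = inside ∷ R , sound' , complete'
    where
    sound' : ∀ {z} → z ∈ inside ∷ R → P z
    sound' here = p0
    sound' (there h) = sound h
    complete' : ∀ {z} → P z → z ∈ inside ∷ R
    complete' {zero} _ = here
    complete' {suc z} pz = there (complete pz)
  extend (no ¬p0) R sound complete = outside ∷ R , sound' , complete'
    where
    sound' : ∀ {z} → z ∈ outside ∷ R → P z
    sound' (there h) = sound h
    complete' : ∀ {z} → P z → z ∈ outside ∷ R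
    complete' {zero} pz = ⊥-elim (¬p0 pz)
    complete' {suc z} pz = there (complete pz)

module Walks {n} (G : Graph n) where

  walk-start : ∀ {S x y} → Walk G S x y → x ∈ S
  walk-start (here x∈) = x∈
  walk-start (step x∈ _ _) = x∈

  walk-end : ∀ {S x y} → Walk G S x y → y ∈ S
  walk-end (here y∈) = y∈
  walk-end (step _ _ w) = walk-end w

  walk-mono : ∀ {S T x y} → S ⊆ T → Walk G S x y → Walk G T x y
  walk-mono S⊆T (here x∈) = here (S⊆T x∈)
  walk-mono S⊆T (step x∈ e w) = step (S⊆T x∈) e (walk-mono S⊆T w)

  infixr 5 _++ʷ_
  _++ʷ_ : ∀ {S x y z} → Walk G S x y → Walk G S y z → Walk G S x z
  here _ ++ʷ w' = w'
  step x∈ e w ++ʷ w' = step x∈ e (w ++ʷ w')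

  walk-reverse : ∀ {S x y} → Walk G S x y → Walk G S y x
  walk-reverse (here x∈) = here x∈
  walk-reverse (step x∈ e w) = walk-reverse w ++ʷ step (walk-start w) (sym G e) (here x∈)

  boundary-edge : ∀ {T A x y} → x ∈ A → y ∉ A → Walk G T x y →
    ∃ λ p → ∃ λ q → p ∈ A × q ∉ A × Adj G p q
  boundary-edge x∈A y∉A (here _) = ⊥-elim (y∉A x∈A)
  boundary-edge {A = A} x∈A y∉A (step {y = z} _ e w) with z ∈? A
  ... | yes z∈A = boundary-edge z∈A y∉A w
  ... | no z∉A = _ , _ , x∈A , z∉A , e

  exit-edge : ∀ {A x y} → Connected G ⊤ → x ∈ A → y ∉ A →
    ∃ λ p → ∃ λ q → p ∈ A × q ∉ A × Adj G p q
  exit-edge {x = x} {y} (_ , walks) x∈A y∉A = boundary-edge x∈A y∉A (walks x y ∈⊤ ∈⊤)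

  singleton-connected : ∀ u → Connected G ⁅ u ⁆
  singleton-connected u = (u , x∈⁅x⁆ u) , walk
    where
    walk : ∀ p q → p ∈ ⁅ u ⁆ → q ∈ ⁅ u ⁆ → Walk G ⁅ u ⁆ p q
    walk p q p∈ q∈ rewrite x∈⁅y⁆⇒x≡y u p∈ | x∈⁅y⁆⇒x≡y u q∈ = here (x∈⁅x⁆ u)

  connected-extend : ∀ {W w y} → Connected G W → w ∈ W → Adj G w y →
    Connected G (W ∪ ⁅ y ⁆)
  connected-extend {W} {w} {y} (_ , walks) w∈W e = (w , into-W w∈W) , λ a b a∈ b∈ →
    to-w a a∈ ++ʷ walk-reverse (to-w b b∈)
    where
    into-W : W ⊆ W ∪ ⁅ y ⁆
    into-W h = x∈p∪q⁺ (inj₁ h)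
    to-w : ∀ a → a ∈ W ∪ ⁅ y ⁆ → Walk G (W ∪ ⁅ y ⁆) a w
    to-w a a∈ with x∈p∪q⁻ W ⁅ y ⁆ a∈
    ... | inj₁ a∈W = walk-mono into-W (walks a w a∈W w∈W)
    ... | inj₂ a∈y rewrite x∈⁅y⁆⇒x≡y y a∈y = step a∈ (sym G e) (here (into-W w∈W))

  component-closed : ∀ {S W w x} → Component G S W → w ∈ W → Walk G S w x → x ∈ W
  component-closed _ w∈W (here _) = w∈W
  component-closed {S} {W} comp@(W⊆S , connW , maximal) w∈W (step {y = y} _ e rest) =
    component-closed comp y∈W rest
    where
    W+y⊆S : W ∪ ⁅ y ⁆ ⊆ S
    W+y⊆S h with x∈p∪q⁻ W ⁅ y ⁆ h
    ... | inj₁ h∈W = W⊆S h∈W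
    ... | inj₂ h∈y rewrite x∈⁅y⁆⇒x≡y y h∈y = walk-start rest
    y∈W : y ∈ W
    y∈W = maximal (W ∪ ⁅ y ⁆) (λ h → x∈p∪q⁺ (inj₁ h)) W+y⊆S
                  (connected-extend connW w∈W e) (x∈p∪q⁺ (inj₂ (x∈⁅x⁆ y)))

  reachable-component : ∀ {S y R} → y ∈ S → Represents R (Walk G S y) →
    Component G S R
  reachable-component {S} {y} {R} y∈S (sound , complete) =
    (walk-end ∘ sound) , ((y , y∈R) , λ a b a∈ b∈ →
      lift (sound a∈) (walk-reverse (sound a∈) ++ʷ sound b∈)) , maximal
    where
    y∈R : y ∈ R
    y∈R = complete (here y∈S)
    lift : ∀ {a b} → Walk G S y a → Walk G S a b → Walk G R a b
    lift to-a (here _) = here (complete to-a)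
    lift to-a (step a∈ e w) =
      step (complete to-a) e (lift (to-a ++ʷ step a∈ e (here (walk-start w))) w)
    maximal : ∀ W' → R ⊆ W' → W' ⊆ S → Connected G W' → W' ⊆ R
    maximal W' R⊆W' W'⊆S (_ , walks) {z} z∈W' =
      complete (walk-mono W'⊆S (walks y z (R⊆W' y∈R) z∈W'))

  -- Every vertex of S lies in a component of G[S] (double-negated: the component
  -- is a reachability set, which need not be decidable).
  ¬¬-component-of : ∀ {S y} → y ∈ S → ¬ ¬ (∃ λ W → Component G S W × y ∈ W)
  ¬¬-component-of y∈S k = ¬¬-representable _ λ (R , rep) →
    k (R , reachable-component y∈S rep , proj₂ rep (here y∈S))

  -- Removing from a connected T a component W of G[T - u] leaves T ─ W connected:
  -- every vertex of T ─ W reaches u without entering W.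
  complement-connected : ∀ {T u W} → Connected G T → u ∈ T → Component G (T - u) W →
    Connected G (T ─ W)
  complement-connected {T} {u} {W} (_ , walks) u∈T comp@(W⊆T-u , _ , _) =
    (u , u∈T─W) , λ x y x∈ y∈ → to-u x∈ ++ʷ walk-reverse (to-u y∈)
    where
    u∉W : u ∉ W
    u∉W h = x∈p─q⇒x∉q T ⁅ u ⁆ (W⊆T-u h) (x∈⁅x⁆ u)
    u∈T─W : u ∈ T ─ W
    u∈T─W = x∈p∧x∉q⇒x∈p─q u∈T u∉W
    avoid : ∀ {x y} → x ∉ W → Walk G T x y → y ≡ u → Walk G (T ─ W) x y
    avoid x∉W (here x∈) _ = here (x∈p∧x∉q⇒x∈p─q x∈ x∉W)
    avoid {x} x∉W (step {y = z} x∈ e w) y≡u with x ≟ᶠ u | z ∈? W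
    ... | yes refl | _ = subst (Walk G (T ─ W) x) (≡.sym y≡u) (here u∈T─W)
    ... | no x≢u | yes z∈W = ⊥-elim (x∉W (component-closed comp z∈W
                                (step (W⊆T-u z∈W) (sym G e) (here (x∈p∧x≢y⇒x∈p-y x∈ x≢u)))))
    ... | no _ | no z∉W = step (x∈p∧x∉q⇒x∈p─q x∈ x∉W) e (avoid z∉W w y≡u)
    to-u : ∀ {x} → x ∈ T ─ W → Walk G (T ─ W) x u
    to-u {x} x∈ = avoid (x∈p─q⇒x∉q T W x∈) (walks x u (p─q⊆p T W x∈) u∈T) refl

4*a≡2*[a+a] : ∀ a → 4 * a ≡ 2 * (a + a)
4*a≡2*[a+a] = solve-∀

module StableTripartition {n} (G : Graph n) (V₁ V₂ V₃ : Subset n)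
  (connG : Connected G ⊤)
  (cover : ∀ x → x ∈ V₁ ⊎ x ∈ V₂ ⊎ x ∈ V₃)
  (disj₁₂ : ∀ x → x ∈ V₁ → x ∈ V₂ → ⊥)
  (disj₁₃ : ∀ x → x ∈ V₁ → x ∈ V₃ → ⊥)
  (disj₂₃ : ∀ x → x ∈ V₂ → x ∈ V₃ → ⊥)
  (conn₁ : Connected G V₁) (conn₂ : Connected G V₂) (conn₃ : Connected G V₃)
  (∣V₁∣≤∣V₂∣ : ∣ V₁ ∣ ≤ ∣ V₂ ∣) (n<2∣V₃∣ : n < 2 * ∣ V₃ ∣)
  (noMerge : ¬ MergeApplicable G V₁ V₂ V₃) (noPull : ¬ PullApplicable G V₁ V₂ V₃)
  where

  open Walks G

  n≡∣V₁∣+∣V₂∣+∣V₃∣ : n ≡ ∣ V₁ ∣ + ∣ V₂ ∣ + ∣ V₃ ∣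
  n≡∣V₁∣+∣V₂∣+∣V₃∣ = begin
    n                              ≡⟨ ≡.sym (∣⊤∣≡n n) ⟩
    ∣ ⊤ {n} ∣                      ≡⟨ cong ∣_∣ (⊆-antisym (λ {x} _ → covered x) (λ _ → ∈⊤)) ⟩
    ∣ (V₁ ∪ V₂) ∪ V₃ ∣             ≡⟨ ∣p∪q∣≡∣p∣+∣q∣ (V₁ ∪ V₂) V₃ disj₁₂,₃ ⟩
    ∣ V₁ ∪ V₂ ∣ + ∣ V₃ ∣           ≡⟨ cong (_+ ∣ V₃ ∣) (∣p∪q∣≡∣p∣+∣q∣ V₁ V₂ (disj₁₂ _)) ⟩
    ∣ V₁ ∣ + ∣ V₂ ∣ + ∣ V₃ ∣       ∎
    where
    open ≡.≡-Reasoning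
    covered : ∀ x → x ∈ (V₁ ∪ V₂) ∪ V₃
    covered x = x∈p∪q⁺ ([ (λ h → inj₁ (x∈p∪q⁺ (inj₁ h))) ,
                          [ (λ h → inj₁ (x∈p∪q⁺ (inj₂ h))) , inj₂ ]′ ]′ (cover x))
    disj₁₂,₃ : ∀ {x} → x ∈ V₁ ∪ V₂ → x ∉ V₃
    disj₁₂,₃ {x} h = [ disj₁₃ x , disj₂₃ x ]′ (x∈p∪q⁻ V₁ V₂ h)

  ∣V₁∣+∣V₂∣<∣V₃∣ : ∣ V₁ ∣ + ∣ V₂ ∣ < ∣ V₃ ∣
  ∣V₁∣+∣V₂∣<∣V₃∣ = +-cancelʳ-< (∣ V₃ ∣) (∣ V₁ ∣ + ∣ V₂ ∣) (∣ V₃ ∣)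
    (subst₂ _<_ n≡∣V₁∣+∣V₂∣+∣V₃∣ (cong (∣ V₃ ∣ +_) (+-identityʳ (∣ V₃ ∣))) n<2∣V₃∣)

  2[∣V₁∣+∣V₂∣]<n : 2 * (∣ V₁ ∣ + ∣ V₂ ∣) < n
  2[∣V₁∣+∣V₂∣]<n = begin-strict
    2 * s        ≡⟨ cong (s +_) (+-identityʳ s) ⟩
    s + s        <⟨ +-monoʳ-< s ∣V₁∣+∣V₂∣<∣V₃∣ ⟩
    s + ∣ V₃ ∣   ≡⟨ ≡.sym n≡∣V₁∣+∣V₂∣+∣V₃∣ ⟩
    n            ∎
    where
    open ≤-Reasoning
    s : ℕ
    s = ∣ V₁ ∣ + ∣ V₂ ∣

  4∣V₁∣<n : 4 * ∣ V₁ ∣ < n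
  4∣V₁∣<n = ≤-<-trans (subst (_≤ 2 * (∣ V₁ ∣ + ∣ V₂ ∣)) (≡.sym (4*a≡2*[a+a] (∣ V₁ ∣)))
                        (*-monoʳ-≤ 2 (+-monoʳ-≤ (∣ V₁ ∣) ∣V₁∣≤∣V₂∣)))
                      2[∣V₁∣+∣V₂∣]<n

  small-fits-V₁ : ∀ {k} → k ≤ ∣ V₁ ∣ → ∣ V₁ ∣ + k < ∣ V₃ ∣
  small-fits-V₁ k≤ = ≤-<-trans (+-monoʳ-≤ (∣ V₁ ∣) (≤-trans k≤ ∣V₁∣≤∣V₂∣)) ∣V₁∣+∣V₂∣<∣V₃∣

  small-fits-V₂ : ∀ {k} → k ≤ ∣ V₁ ∣ → ∣ V₂ ∣ + k < ∣ V₃ ∣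
  small-fits-V₂ k≤ = ≤-<-trans (+-monoʳ-≤ (∣ V₂ ∣) k≤)
                           (subst (_< ∣ V₃ ∣) (+-comm (∣ V₁ ∣) (∣ V₂ ∣)) ∣V₁∣+∣V₂∣<∣V₃∣)

  1≤∣V₂∣ : 1 ≤ ∣ V₂ ∣
  1≤∣V₂∣ with proj₁ conn₂
  ... | x , x∈ = subst (_≤ ∣ V₂ ∣) (∣⁅x⁆∣≡1 x)
                   (p⊆q⇒∣p∣≤∣q∣ λ h → subst (_∈ V₂) (≡.sym (x∈⁅y⁆⇒x≡y x h)) x∈)

  touches-V₃ : ∀ {A} → Nonempty A → (∀ {x} → x ∈ A → x ∉ V₃) →
    (∀ {p q} → p ∈ A → q ∉ A → Adj G p q → q ∉ V₃ → ⊥) → AdjacentSets G A V₃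
  touches-V₃ (x , x∈A) A∩V₃≡∅ exits-to-V₃ with proj₁ conn₃
  ... | y , y∈V₃ with exit-edge connG x∈A (λ y∈A → A∩V₃≡∅ y∈A y∈V₃)
  ... | p , q , p∈A , q∉A , e =
    p , q , p∈A , decidable-stable (q ∈? V₃) (exits-to-V₃ p∈A q∉A e) , e

  -- Since Merge is forbidden, both small parts touch V₃.
  V₁-adj-V₃ : AdjacentSets G V₁ V₃
  V₁-adj-V₃ = touches-V₃ (proj₁ conn₁) (disj₁₃ _) exit
    where
    exit : ∀ {p q} → p ∈ V₁ → q ∉ V₁ → Adj G p q → q ∉ V₃ → ⊥
    exit {p} {q} p∈V₁ q∉V₁ e q∉V₃ =
      [ q∉V₁ , [ (λ q∈V₂ → noMerge (p , q , p∈V₁ , q∈V₂ , e)) , q∉V₃ ]′ ]′ (cover q)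

  V₂-adj-V₃ : AdjacentSets G V₂ V₃
  V₂-adj-V₃ = touches-V₃ (proj₁ conn₂) (disj₂₃ _) exit
    where
    exit : ∀ {p q} → p ∈ V₂ → q ∉ V₂ → Adj G p q → q ∉ V₃ → ⊥
    exit {p} {q} p∈V₂ q∉V₂ e q∉V₃ =
      [ (λ q∈V₁ → noMerge (q , p , q∈V₁ , p∈V₂ , sym G e)) , [ q∉V₂ , q∉V₃ ]′ ]′ (cover q)

  module AtEdge (u v : Fin n) (u∈V₃ : u ∈ V₃) (v∈V₁ : v ∈ V₁) (uv : Adj G u v) where

    -- Otherwise {u} could be pulled to V₁.
    V₃-u-disconnected : ¬ Connected G (V₃ - u)
    V₃-u-disconnected conn@((z , z∈V₃-u) , _) =
      noPull (⁅ u ⁆ , inj₁ ((⁅u⁆⊆V₃ , z , p─q⊆p V₃ ⁅ u ⁆ z∈V₃-u , x∈p─q⇒x∉q V₃ ⁅ u ⁆ z∈V₃-u) ,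
                            (u , x∈⁅x⁆ u) , singleton-connected u , conn ,
                            (u , v , x∈⁅x⁆ u , v∈V₁ , uv) , size))
      where
      ⁅u⁆⊆V₃ : ⁅ u ⁆ ⊆ V₃
      ⁅u⁆⊆V₃ h = subst (_∈ V₃) (≡.sym (x∈⁅y⁆⇒x≡y u h)) u∈V₃
      size : ∣ V₁ ∣ + ∣ ⁅ u ⁆ ∣ < ∣ V₃ ∣
      size rewrite ∣⁅x⁆∣≡1 u = ≤-<-trans (+-monoʳ-≤ (∣ V₁ ∣) 1≤∣V₂∣) ∣V₁∣+∣V₂∣<∣V₃∣

    module ComponentAt (W : Subset n) (comp : Component G (V₃ - u) W) where

      W-connected : Connected G W
      W-connected = proj₁ (proj₂ comp)

      W⊆V₃ : W ⊆ V₃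
      W⊆V₃ h = p─q⊆p V₃ ⁅ u ⁆ (proj₁ comp h)

      u∉W : u ∉ W
      u∉W h = x∈p─q⇒x∉q V₃ ⁅ u ⁆ (proj₁ comp h) (x∈⁅x⁆ u)

      V₃─W-connected : Connected G (V₃ ─ W)
      V₃─W-connected = complement-connected conn₃ u∈V₃ comp

      pull-component : ∀ {Vᵢ} → AdjacentSets G W Vᵢ → ∣ Vᵢ ∣ + ∣ W ∣ < ∣ V₃ ∣ →
        PullVia G Vᵢ V₃ W
      pull-component W~Vᵢ size =
        (W⊆V₃ , u , u∈V₃ , u∉W) , proj₁ W-connected , W-connected ,
        V₃─W-connected , W~Vᵢ , size

      -- Otherwise the rest V₃ ─ W, which contains u, could be pulled to V₁.
      ∣W∣≤∣V₁∣ : ∣ W ∣ ≤ ∣ V₁ ∣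
      ∣W∣≤∣V₁∣ with ∣ W ∣ ≤? ∣ V₁ ∣
      ... | yes ≤ = ≤
      ... | no ≰ with proj₁ W-connected
      ...   | w , w∈W = ⊥-elim (noPull (V₃ ─ W , inj₁
            ((p─q⊆p V₃ W , w , W⊆V₃ w∈W , λ h → x∈p─q⇒x∉q V₃ W h w∈W) ,
             (u , x∈p∧x∉q⇒x∈p─q u∈V₃ u∉W) , V₃─W-connected ,
             subst (Connected G) (≡.sym (p─[p─q]≡q V₃ W W⊆V₃)) W-connected ,
             (u , v , x∈p∧x∉q⇒x∈p─q u∈V₃ u∉W , v∈V₁ , uv) , size)))
        where
        size : ∣ V₁ ∣ + ∣ V₃ ─ W ∣ < ∣ V₃ ∣
        size = subst₂ _<_ (+-comm (∣ V₃ ─ W ∣) (∣ V₁ ∣)) (∣p─q∣+∣q∣≡∣p∣ V₃ W W⊆V₃)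
                 (+-monoʳ-< (∣ V₃ ─ W ∣) (≰⇒> ≰))

      W-not-adj-V₁ : ¬ AdjacentSets G W V₁
      W-not-adj-V₁ W~V₁ = noPull (W , inj₁ (pull-component W~V₁ (small-fits-V₁ ∣W∣≤∣V₁∣)))

      W-not-adj-V₂ : ¬ AdjacentSets G W V₂
      W-not-adj-V₂ W~V₂ = noPull (W , inj₂ (pull-component W~V₂ (small-fits-V₂ ∣W∣≤∣V₁∣)))

    -- Every y ∈ V₃ - u lies in a component of V₃ - u, which touches neither V₁ nor V₂.
    only-u-adjacent : ∀ x y → x ∈ V₁ ∪ V₂ → y ∈ V₃ → ¬ y ≡ u → ¬ Adj G x y
    only-u-adjacent x y x∈ y∈V₃ y≢u xy =
      ¬¬-component-of (x∈p∧x≢y⇒x∈p-y y∈V₃ y≢u) λ (W , comp , y∈W) →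
        let open ComponentAt W comp in
        [ (λ x∈V₁ → W-not-adj-V₁ (y , x , y∈W , x∈V₁ , sym G xy)) ,
          (λ x∈V₂ → W-not-adj-V₂ (y , x , y∈W , x∈V₂ , sym G xy)) ]′ (x∈p∪q⁻ V₁ V₂ x∈)

lemma4 : ∀ {n} (G : Graph n) (V₁ V₂ V₃ : Subset n) →
    Connected G ⊤ →
    FeasibleTripartition G V₁ V₂ V₃ →
    ∣ V₁ ∣ ≤ ∣ V₂ ∣ → ∣ V₂ ∣ ≤ ∣ V₃ ∣ → n < 2 * ∣ V₃ ∣ →
    ¬ MergeApplicable G V₁ V₂ V₃ → ¬ PullApplicable G V₁ V₂ V₃ →
    ((2 * (∣ V₁ ∣ + ∣ V₂ ∣) < n) × (4 * ∣ V₁ ∣ < n) ×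
      ¬ AdjacentSets G V₁ V₂ × AdjacentSets G V₁ V₃ × AdjacentSets G V₂ V₃) ×
    (∀ u v → u ∈ V₃ → v ∈ V₁ → Adj G u v →
      ¬ Connected G (V₃ - u) ×
      (∀ W → Component G (V₃ - u) W → ∣ W ∣ ≤ ∣ V₁ ∣ × ¬ AdjacentSets G W V₁)) ×
    (∀ u v → u ∈ V₃ → v ∈ V₁ → Adj G u v →
      ∀ x y → (x ∈ V₁ ∪ V₂) → y ∈ V₃ → ¬ y ≡ u → ¬ Adj G x y)
lemma4 G V₁ V₂ V₃ connG (cover , d₁₂ , d₁₃ , d₂₃ , conn₁ , conn₂ , conn₃)
       ∣V₁∣≤∣V₂∣ _ n<2∣V₃∣ noMerge noPull =
  (2[∣V₁∣+∣V₂∣]<n , 4∣V₁∣<n , noMerge , V₁-adj-V₃ , V₂-adj-V₃) ,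
  (λ u v u∈V₃ v∈V₁ uv → let open AtEdge u v u∈V₃ v∈V₁ uv in
     V₃-u-disconnected ,
     λ W comp → let open ComponentAt W comp in ∣W∣≤∣V₁∣ , W-not-adj-V₁) ,
  (λ u v u∈V₃ v∈V₁ uv → AtEdge.only-u-adjacent u v u∈V₃ v∈V₁ uv)
  where
  open StableTripartition G V₁ V₂ V₃ connG cover d₁₂ d₁₃ d₂₃ conn₁ conn₂ conn₃
         ∣V₁∣≤∣V₂∣ n<2∣V₃∣ noMerge noPull
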